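{- Let $A$ be a finite set of alternatives and let $\mathcal D\subseteq\mathcal L(A)$ be a maximal Condorcet domain. Then the following are equivalent: (i) $\mathcal D$ is a peak-pit Condorcet domain; (ii) $\mathcal D$ is directly connected; (iii) $\mathcal D$ is connected.
   Context: $\mathcal L(A)$ is the set of linear orders on the finite set $A$; a linear order is written as a word $x_1x_2\cdots x_n$ listing the alternatives from top (most preferred) to bottom. A domain is any subset $\mathcal D\subseteq\mathcal L(A)$. For $B\subseteq A$, $R_B$ denotes the restriction of $R$ to $B$ and $\mathcal D_B=\{R_B:R\in\mathcal D\}$. For distinct $a,b,c\in A$, $x\in\{a,b,c\}$ and $k\in\{1,2,3\}$, $\mathcal D_{\{a,b,c\}}$ satisfies the never-condition $xN_{\{a,b,c\}}k$ if no $x_1x_2x_3\in\mathcal D_{\{a,b,c\}}$ has $x_k=x$ ($k=1$: never-top, $k=2$: never-middle, $k=3$: never-bottom). $\mathcal D$ is a Condorcet domain if for every triple of distinct $a,b,c\in A$, $\mathcal D_{\{a,b,c\}}$ satisfies at least one never-condition; it is a peak-pit Condorcet domain if for every such triple $\mathcal D_{\{a,b,c\}}$ satisfies at least one never-top or never-bottom condition. A Condorcet domain $\mathcal D$ is maximal if no Condorcet domain $\mathcal D'\subseteq\mathcal L(A)$ strictly contains it. Two linear orders are alike if one is obtained from the other by swapping two alternatives in adjacent positions. A path of alike linear orders connecting $R$ and $T$ is a sequence $(R_1,\dots,R_k)$ with $R_1=R$, $R_k=T$ and $R_i,R_{i+1}$ alike for all $i$; a geodesic connecting $R$ and $T$ is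 such a path of minimum possible length $k$. $\mathcal D$ is connected if any two $R,T\in\mathcal D$ are connected by a path all of whose orders lie in $\mathcal D$, and directly connected if any two $R,T\in\mathcal D$ are connected by a geodesic all of whose orders lie in $\mathcal D$. -}

module Defs where

open import Data.Nat using (ℕ; zero; suc; _≤_; _<_)
open import Data.Fin using (Fin; toℕ)
open import Data.Vec using (Vec; lookup)
open import Data.Product using (Σ; ∃; ∃-syntax; _×_; _,_)
open import Data.Sum using (_⊎_)
open import Data.Unit using (⊤)
open import Relation.Nullary using (¬_)
open import Relation.Binary.PropositionalEquality using (_≡_; _≢_)
open import Function.Definitions using (Injective)

-- The finite set of alternatives A is Fin n.  A linear order is written as a
-- word x₁x₂⋯xₙ (top to bottom): a vector listing each alternative exactly once.
Word : ℕ → Set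
Word n = Vec (Fin n) n

IsLinearOrder : ∀ {n} → Word n → Set
IsLinearOrder R = Injective _≡_ _≡_ (lookup R)

Domain : ℕ → Set₁
Domain n = Word n → Set

IsDomain : ∀ {n} → Domain n → Set
IsDomain D = ∀ R → D R → IsLinearOrder R

_⊆_ : ∀ {n} → Domain n → Domain n → Set
D ⊆ D′ = ∀ R → D R → D′ R

Above : ∀ {n} → Word n → Fin n → Fin n → Set
Above R x y = ∃[ i ] ∃[ j ] (lookup R i ≡ x × lookup R j ≡ y × toℕ i < toℕ j)

Arrangement : ∀ {n} → Fin n → Fin n → Fin n → Fin n → Fin n → Fin n → Set
Arrangement a b c x₁ x₂ x₃ =
    (x₁ ≡ a × x₂ ≡ b × x₃ ≡ c) ⊎ (x₁ ≡ a × x₂ ≡ c × x₃ ≡ b)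
  ⊎ (x₁ ≡ b × x₂ ≡ a × x₃ ≡ c) ⊎ (x₁ ≡ b × x₂ ≡ c × x₃ ≡ a)
  ⊎ (x₁ ≡ c × x₂ ≡ a × x₃ ≡ b) ⊎ (x₁ ≡ c × x₂ ≡ b × x₃ ≡ a)

RestrictsTo : ∀ {n} → Word n → Fin n → Fin n → Fin n → Set
RestrictsTo R x₁ x₂ x₃ = Above R x₁ x₂ × Above R x₂ x₃

InRestriction : ∀ {n} → Domain n → Fin n → Fin n → Fin n →
                Fin n → Fin n → Fin n → Set
InRestriction D a b c x₁ x₂ x₃ =
  Arrangement a b c x₁ x₂ x₃ × (∃[ R ] (D R × RestrictsTo R x₁ x₂ x₃))

data Pos : Set where
  p1 p2 p3 : Pos

select : ∀ {A : Set} → Pos → A → A → A → A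
select p1 x₁ x₂ x₃ = x₁
select p2 x₁ x₂ x₃ = x₂
select p3 x₁ x₂ x₃ = x₃

Never : ∀ {n} → Domain n → Fin n → Fin n → Fin n → Fin n → Pos → Set
Never D a b c x k = ∀ x₁ x₂ x₃ → InRestriction D a b c x₁ x₂ x₃ →
                    select k x₁ x₂ x₃ ≢ x

Distinct3 : ∀ {n} → Fin n → Fin n → Fin n → Set
Distinct3 a b c = a ≢ b × a ≢ c × b ≢ c

InTriple : ∀ {n} → Fin n → Fin n → Fin n → Fin n → Set
InTriple a b c x = x ≡ a ⊎ x ≡ b ⊎ x ≡ c

IsCondorcet : ∀ {n} → Domain n → Set
IsCondorcet D = ∀ a b c → Distinct3 a b c →
  ∃[ x ] ∃[ k ] (InTriple a b c x × Never D a b c x k)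

IsPeakPit : ∀ {n} → Domain n → Set
IsPeakPit D = ∀ a b c → Distinct3 a b c →
  ∃[ x ] (InTriple a b c x × (Never D a b c x p1 ⊎ Never D a b c x p3))

IsMaximalCondorcet : ∀ {n} → Domain n → Set₁
IsMaximalCondorcet D =
  IsDomain D × IsCondorcet D ×
  (∀ D′ → IsDomain D′ → IsCondorcet D′ → D ⊆ D′ → D′ ⊆ D)

Alike : ∀ {n} → Word n → Word n → Set
Alike R T = ∃[ i ] ∃[ j ] (toℕ j ≡ suc (toℕ i) ×
  lookup T i ≡ lookup R j × lookup T j ≡ lookup R i ×
  (∀ k → k ≢ i → k ≢ j → lookup T k ≡ lookup R k))

data PathIn {n} (P : Domain n) : Word n → Word n → ℕ → Set where
  single : ∀ {R} → P R → PathIn P R R 1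
  step   : ∀ {R S T k} → P R → Alike R S → PathIn P S T k →
           PathIn P R T (suc k)

IsConnected : ∀ {n} → Domain n → Set
IsConnected D = ∀ R T → D R → D T → ∃[ k ] PathIn D R T k

IsDirectlyConnected : ∀ {n} → Domain n → Set
IsDirectlyConnected D = ∀ R T → D R → D T →
  ∃[ k ] (PathIn D R T k × (∀ k′ → PathIn IsLinearOrder R T k′ → k ≤ k′))

{-# OPTIONS --safe #-}
-- (iii) ⇒ (i): suppose D satisfies xN₂ on a triple. An alike step reorders at most one pair of
-- the triple, so it cannot take x off the top without putting it in the middle; by connectedness,
-- x is then on top in every member of D (so xN₃ holds) as soon as it is on top in one, and
-- otherwise xN₁ holds.
-- (i) ⇒ (ii): a step changes the number of pairs ordered oppositely by R and T by at most one, so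
-- that number bounds the length of every path, and a path of that length is built by induction.
-- Swap an adjacent pair of R that T orders the other way. If the new order S is not in D,
-- maximality gives a triple on which D ∪ {S} satisfies no never-condition; as the condition of D
-- there is never-top or never-bottom, some Q ∈ D then sides with R on one and with T on another of
-- the pairs of that triple that R and T order oppositely. The majority order M of R, T, Q lies in D
-- (a maximal Condorcet domain is closed under majority) and strictly between R and T, and
-- geodesics R → M → T combine.
module Submission where

open import Defs
open import Data.Bool.Base using (Bool; true; false; not; _∧_; _∨_; if_then_else_)
open import Data.Bool.Properties using () renaming (_≟_ to _≟ᵇ_)
open import Data.Fin.Base as Fin using (Fin; toℕ; fromℕ<; punchOut) renaming (_<_ to _<ᶠ_)
open import Data.Fin.Permutation.Components using (transpose; transpose-inverse)
open import Data.Fin.Properties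
  using (_≟_; any?; all?; pigeonhole; punchOut-injective; toℕ-injective; toℕ-fromℕ<; toℕ<n; <⇒≢)
open import Data.List.Base using (List; []; _∷_)
open import Data.List.Membership.Propositional using (_∈_; lose)
import Data.List.Relation.Unary.All as All
open import Data.List.Relation.Unary.Any as Any using (here; there; satisfied)
open import Data.Nat.Base as ℕ using (ℕ; zero; suc; _+_; _*_; _≤_; _<_; _<ᵇ_; z≤n; s≤s)
open import Data.Nat.Induction using (<-wellFounded)
import Data.Nat.Properties as ℕ
open import Algebra.Properties.Semiring.Sum ℕ.+-*-semiring
  using (sum; sum-syntax; sum-cong-≗; ∑-distrib-+; sum-replicate-zero; *-distribˡ-sum)
open import Data.Product.Base using (∃; ∃₂; _×_; _,_; proj₁; proj₂)
open import Data.Sum.Base using (_⊎_; inj₁; inj₂)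
open import Data.Unit.Base using (⊤; tt)
open import Data.Vec.Base using (Vec; []; _∷_; lookup; tabulate; allFin)
open import Data.Vec.Properties using (lookup∘tabulate; tabulate∘lookup; tabulate-cong; lookup-allFin)
open import Function.Base using (_∘_)
open import Function.Bundles using (_⇔_; mk⇔; Equivalence)
open import Function.Definitions using (Injective)
open import Induction.WellFounded using (Acc; acc)
open import Level using (0ℓ)
open import Relation.Binary.Core using (Rel)
open import Relation.Binary.Definitions
  using (Decidable; DecidableEquality; Irreflexive; Asymmetric; Transitive; Trichotomous; tri<; tri≈; tri>)
open import Relation.Binary.PropositionalEquality
open import Relation.Binary.Structures using (IsStrictTotalOrder)
open import Relation.Nullary using (¬_; Dec; yes; no; does; contradiction)
open import Relation.Nullary.Decidable
  using (map′; _×-dec_; _⊎-dec_; _→-dec_; ¬?; dec-true; dec-false; does-⇔; from-yes)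

private variable
  n : ℕ

-- Linear orders as words

injective⇒surjective : {f : Fin n → Fin n} → Injective _≡_ _≡_ f → ∀ y → ∃ λ x → f x ≡ y
injective⇒surjective {zero} inj ()
injective⇒surjective {suc m} {f} inj y with any? (λ x → f x ≟ y)
... | yes hit = hit
... | no miss = collision (pigeonhole (ℕ.n<1+n m) (λ x → punchOut (y≢f x)))
  where
  y≢f : ∀ x → y ≢ f x
  y≢f x = miss ∘ (x ,_) ∘ sym
  collision : (∃₂ λ i j → i <ᶠ j × punchOut (y≢f i) ≡ punchOut (y≢f j)) → ∃ λ x → f x ≡ y
  collision (i , j , i<j , same) = contradiction (inj (punchOut-injective (y≢f i) (y≢f j) same)) (<⇒≢ i<j)

-- a record, so that the word can be inferred from a proof of its linearity
record Linear (R : Word n) : Set where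
  constructor linear
  field injective : IsLinearOrder R

open Linear public

trans∧irr∧connex⇒isStrictTotalOrder : {_≺_ : Rel (Fin n) 0ℓ} → Irreflexive _≡_ _≺_ → Transitive _≺_ →
                   (∀ {x y} → x ≢ y → x ≺ y ⊎ y ≺ x) → IsStrictTotalOrder _≡_ _≺_
trans∧irr∧connex⇒isStrictTotalOrder {_≺_ = _≺_} irrefl trans′ connex = record
  { isStrictPartialOrder = record
    { isEquivalence = isEquivalence ; irrefl = irrefl ; trans = trans′ ; <-resp-≈ = resp₂ _≺_ }
  ; compare = compare
  }
  where
  asym : ∀ {x y} → x ≺ y → ¬ y ≺ x
  asym x≺y y≺x = irrefl refl (trans′ x≺y y≺x)
  compare : Trichotomous _≡_ _≺_
  compare x y with x ≟ y
  ... | yes refl = tri≈ (irrefl refl) refl (irrefl refl)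
  ... | no x≢y with connex x≢y
  ...   | inj₁ x≺y = tri< x≺y x≢y (asym x≺y)
  ...   | inj₂ y≺x = tri> (asym y≺x) x≢y y≺x

Above? : (R : Word n) → ∀ x y → Dec (Above R x y)
Above? R x y = any? λ i → any? λ j → (lookup R i ≟ x) ×-dec (lookup R j ≟ y) ×-dec (toℕ i ℕ.<? toℕ j)

module _ {R : Word n} (lin : Linear R) where

  position : ∀ x → ∃ λ i → lookup R i ≡ x
  position = injective⇒surjective (injective lin)

  Above-irrefl : Irreflexive _≡_ (Above R)
  Above-irrefl refl (i , j , refl , Rj≡x , i<j) = <⇒≢ i<j (injective lin (sym Rj≡x))

  Above-trans : Transitive (Above R)
  Above-trans (i , j , Ri , Rj , i<j) (k , l , Rk , Rl , k<l)
    with refl ← injective lin (trans Rj (sym Rk)) = i , l , Ri , Rl , ℕ.<-trans i<j k<l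

  Above-connex : ∀ {x y} → x ≢ y → Above R x y ⊎ Above R y x
  Above-connex {x} {y} x≢y with position x | position y
  ... | i , Ri | j , Rj with ℕ.<-cmp (toℕ i) (toℕ j)
  ... | tri< i<j _ _ = inj₁ (i , j , Ri , Rj , i<j)
  ... | tri≈ _ i≡j _ = contradiction (trans (sym Ri) (trans (cong (lookup R) (toℕ-injective i≡j)) Rj)) x≢y
  ... | tri> _ _ j<i = inj₂ (j , i , Rj , Ri , j<i)

  Above-isStrictTotalOrder : IsStrictTotalOrder _≡_ (Above R)
  Above-isStrictTotalOrder = trans∧irr∧connex⇒isStrictTotalOrder Above-irrefl Above-trans Above-connex

  open IsStrictTotalOrder Above-isStrictTotalOrder public
    using () renaming (asym to Above-asym)

  Above-flip : ∀ {x y} → x ≢ y → ¬ Above R x y → Above R y x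
  Above-flip x≢y x≯y with Above-connex x≢y
  ... | inj₁ x>y = contradiction x>y x≯y
  ... | inj₂ y>x = y>x

≡-from-Above : {R T : Word n} → Linear R → Linear T → (∀ {x y} → Above R x y → Above T x y) → R ≡ T
≡-from-Above {n} {R} {T} linR linT R⊆T =
  trans (sym (tabulate∘lookup R)) (trans (tabulate-cong (λ i → agree (suc (toℕ i)) i ℕ.≤-refl)) (tabulate∘lookup T))
  where
  agree : ∀ m i → toℕ i ℕ.< m → lookup R i ≡ lookup T i
  agree (suc m) i (s≤s i≤m) with position linT (lookup R i)
  ... | p , Tp with ℕ.<-cmp (toℕ p) (toℕ i)
  ... | tri< p<i _ _ = contradiction (injective linR (trans (agree m p (ℕ.<-≤-trans p<i i≤m)) Tp)) (<⇒≢ p<i)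
  ... | tri≈ _ p≡i _ = trans (sym Tp) (cong (lookup T) (toℕ-injective p≡i))
  ... | tri> _ _ i<p with position linR (lookup T i)
  ...   | q , Rq with ℕ.<-cmp (toℕ q) (toℕ i)
  ...     | tri< q<i _ _ = contradiction (injective linT (trans (sym (agree m q (ℕ.<-≤-trans q<i i≤m))) Rq)) (<⇒≢ q<i)
  ...     | tri≈ _ q≡i _ = trans (cong (lookup R) (toℕ-injective (sym q≡i))) Rq
  ...     | tri> _ _ i<q = contradiction (R⊆T (i , q , refl , Rq , i<q)) (Above-asym linT (i , p , refl , Tp , i<p))

-- Alike orders

record AlikeAt (i j : Fin n) (R T : Word n) : Set where
  constructor alikeAt
  field
    adjacent  : toℕ j ≡ suc (toℕ i)
    swappedˡ  : lookup T i ≡ lookup R j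
    swappedʳ  : lookup T j ≡ lookup R i
    unchanged : ∀ k → k ≢ i → k ≢ j → lookup T k ≡ lookup R k

module _ {R T : Word n} where

  alike⇒alikeAt : Alike R T → ∃₂ λ i j → AlikeAt i j R T
  alike⇒alikeAt (i , j , adj , Ti , Tj , Tk) = i , j , alikeAt adj Ti Tj Tk

  alikeAt⇒alike : ∀ {i j} → AlikeAt i j R T → Alike R T
  alikeAt⇒alike {i} {j} (alikeAt adj Ti Tj Tk) = i , j , adj , Ti , Tj , Tk

adjacent⇒< : {i j : Fin n} → toℕ j ≡ suc (toℕ i) → toℕ i ℕ.< toℕ j
adjacent⇒< j≡1+i = subst (_ ℕ.<_) (sym j≡1+i) ℕ.≤-refl

module _ (i j : Fin n) where

  transpose-matchˡ : transpose i j i ≡ j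
  transpose-matchˡ rewrite dec-true (i ≟ i) refl = refl

  transpose-matchʳ : transpose i j j ≡ i
  transpose-matchʳ = by-cases (j ≟ i)
    where
    by-cases : Dec (j ≡ i) → transpose i j j ≡ i
    by-cases (yes refl) = transpose-matchˡ
    by-cases (no j≢i) rewrite dec-false (j ≟ i) j≢i | dec-true (j ≟ j) refl = refl

  transpose-other : ∀ {k} → k ≢ i → k ≢ j → transpose i j k ≡ k
  transpose-other {k} k≢i k≢j rewrite dec-false (k ≟ i) k≢i | dec-false (k ≟ j) k≢j = refl

  transpose-injective : Injective _≡_ _≡_ (transpose i j)
  transpose-injective {k} {l} eq =
    trans (sym (transpose-inverse j i)) (trans (cong (transpose j i) eq) (transpose-inverse j i))

  private
    via : ∀ p q {p′ q′} → transpose i j p ≡ p′ → transpose i j q ≡ q′ → toℕ p′ ℕ.< toℕ q′ →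
          toℕ (transpose i j p) ℕ.< toℕ (transpose i j q)
    via _ _ refl refl p′<q′ = p′<q′

  transpose-< : toℕ j ≡ suc (toℕ i) → ∀ {p q} → toℕ p ℕ.< toℕ q → ¬ (p ≡ i × q ≡ j) →
                toℕ (transpose i j p) ℕ.< toℕ (transpose i j q)
  transpose-< j≡1+i {p} {q} p<q not-ij = by-cases (p ≟ i) (p ≟ j) (q ≟ i) (q ≟ j)
    where
    i<j = adjacent⇒< j≡1+i
    by-cases : Dec (p ≡ i) → Dec (p ≡ j) → Dec (q ≡ i) → Dec (q ≡ j) →
               toℕ (transpose i j p) ℕ.< toℕ (transpose i j q)
    by-cases (yes refl) _ _ (yes refl) = contradiction (refl , refl) not-ij
    by-cases (yes refl) _ (yes refl) _ = contradiction p<q (ℕ.<-irrefl refl)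
    by-cases (yes refl) _ (no q≢i) (no q≢j) =
      via p q transpose-matchˡ (transpose-other q≢i q≢j)
        (ℕ.≤∧≢⇒< (subst (ℕ._≤ toℕ q) (sym j≡1+i) p<q) (q≢j ∘ toℕ-injective ∘ sym))
    by-cases (no p≢i) (yes refl) _ _ =
      via p q transpose-matchʳ (transpose-other (λ { refl → ℕ.<-asym p<q i<j }) (λ { refl → ℕ.<-irrefl refl p<q }))
        (ℕ.<-trans i<j p<q)
    by-cases (no p≢i) (no p≢j) (yes refl) _ = via p q (transpose-other p≢i p≢j) transpose-matchˡ (ℕ.<-trans p<q i<j)
    by-cases (no p≢i) (no p≢j) (no _) (yes refl) =
      via p q (transpose-other p≢i p≢j) transpose-matchʳ
        (ℕ.≤∧≢⇒< (ℕ.s≤s⁻¹ (subst (toℕ p ℕ.<_) j≡1+i p<q)) (p≢i ∘ toℕ-injective))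
    by-cases (no p≢i) (no p≢j) (no q≢i) (no q≢j) = via p q (transpose-other p≢i p≢j) (transpose-other q≢i q≢j) p<q

swap : Word n → Fin n → Fin n → Word n
swap R i j = tabulate (lookup R ∘ transpose i j)

module _ {R : Word n} {i j : Fin n} where

  swap-alikeAt : toℕ j ≡ suc (toℕ i) → AlikeAt i j R (swap R i j)
  swap-alikeAt j≡1+i = alikeAt j≡1+i
    (trans (lookup∘tabulate _ i) (cong (lookup R) (transpose-matchˡ i j)))
    (trans (lookup∘tabulate _ j) (cong (lookup R) (transpose-matchʳ i j)))
    λ k k≢i k≢j → trans (lookup∘tabulate _ k) (cong (lookup R) (transpose-other i j k≢i k≢j))

  swap-linear : Linear R → Linear (swap R i j)
  swap-linear lin = linear λ {k} {l} eq → transpose-injective i j (injective lin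
    (trans (sym (lookup∘tabulate _ k)) (trans eq (lookup∘tabulate _ l))))

module _ {R S : Word n} {i j : Fin n} where

  AlikeAt-sym : AlikeAt i j R S → AlikeAt i j S R
  AlikeAt-sym (alikeAt j≡1+i Si Sj Sk) = alikeAt j≡1+i (sym Sj) (sym Si) λ k k≢i k≢j → sym (Sk k k≢i k≢j)

  lookup-transpose : AlikeAt i j R S → ∀ k → lookup S (transpose i j k) ≡ lookup R k
  lookup-transpose (alikeAt _ Si Sj Sk) k = by-cases (k ≟ i) (k ≟ j)
    where
    by-cases : Dec (k ≡ i) → Dec (k ≡ j) → lookup S (transpose i j k) ≡ lookup R k
    by-cases (yes refl) _ = trans (cong (lookup S) (transpose-matchˡ i j)) Sj
    by-cases (no _) (yes refl) = trans (cong (lookup S) (transpose-matchʳ i j)) Si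
    by-cases (no k≢i) (no k≢j) = trans (cong (lookup S) (transpose-other i j k≢i k≢j)) (Sk k k≢i k≢j)

  Above-alikeAt : AlikeAt i j R S → ∀ {x y} → Above R x y → ¬ (x ≡ lookup R i × y ≡ lookup R j) → Above S x y
  Above-alikeAt al@(alikeAt j≡1+i _ _ _) (p , q , Rp , Rq , p<q) not-ij =
    transpose i j p , transpose i j q ,
    trans (lookup-transpose al p) Rp , trans (lookup-transpose al q) Rq ,
    transpose-< i j j≡1+i p<q λ { (refl , refl) → not-ij (sym Rp , sym Rq) }

  Above-before : AlikeAt i j R S → Above R (lookup R i) (lookup R j)
  Above-before (alikeAt j≡1+i _ _ _) = i , j , refl , refl , adjacent⇒< j≡1+i

  Above-after : AlikeAt i j R S → Above S (lookup R j) (lookup R i)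
  Above-after (alikeAt j≡1+i Si Sj _) = i , j , Si , Sj , adjacent⇒< j≡1+i

linear? : (W : Word n) → Dec (Linear W)
linear? W = map′ (λ inj → linear λ {i} {j} → inj i j) (λ lin i j → injective lin {i} {j})
  (all? λ i → all? λ j → (lookup W i ≟ lookup W j) →-dec (i ≟ j))

∃-vector? : ∀ {k} m {P : Vec (Fin k) m → Set} → (∀ v → Dec (P v)) → Dec (∃ P)
∃-vector? zero P? = map′ ([] ,_) (λ { ([] , p) → p }) (P? [])
∃-vector? (suc m) P? = map′ (λ (x , v , p) → x ∷ v , p) (λ { (x ∷ v , p) → x , v , p }) (any? λ x → ∃-vector? m (P? ∘ (x ∷_)))

∃-word? : {P : Word n → Set} → (∀ W → Dec (P W)) → Dec (∃ P)
∃-word? {n} = ∃-vector? n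

-- Inversions

indicator : {P : Set} → Dec P → ℕ
indicator d = if does d then 1 else 0

module _ {P : Set} (d : Dec P) where

  indicator-yes : P → indicator d ≡ 1
  indicator-yes p rewrite dec-true d p = refl

  indicator-no : ¬ P → indicator d ≡ 0
  indicator-no ¬p rewrite dec-false d ¬p = refl

∑-mono-≤ : ∀ {m} {f g : Fin m → ℕ} → (∀ i → f i ≤ g i) → sum f ≤ sum g
∑-mono-≤ {zero} f≤g = z≤n
∑-mono-≤ {suc m} f≤g = ℕ.+-mono-≤ (f≤g Fin.zero) (∑-mono-≤ (f≤g ∘ Fin.suc))

term≤∑ : ∀ {m} (f : Fin m → ℕ) i → f i ≤ sum f
term≤∑ f Fin.zero = ℕ.m≤m+n _ _
term≤∑ f (Fin.suc i) = ℕ.≤-trans (term≤∑ (f ∘ Fin.suc) i) (ℕ.m≤n+m _ _)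

∑-zero : ∀ {m} {f : Fin m → ℕ} → (∀ i → f i ≡ 0) → sum f ≡ 0
∑-zero {m} f≡0 = trans (sum-cong-≗ f≡0) (sum-replicate-zero m)

∑-indicator : ∀ {m} (u : Fin m) → ∑[ x < m ] indicator (x ≟ u) ≡ 1
∑-indicator {suc m} Fin.zero = cong suc (∑-zero {m} {f = λ x → indicator (Fin.suc x ≟ Fin.zero)} λ _ → refl)
∑-indicator {suc m} (Fin.suc u) = ∑-indicator u

module _ {n : ℕ} where

  ∑∑ : (Fin n → Fin n → ℕ) → ℕ
  ∑∑ f = ∑[ x < n ] ∑[ y < n ] f x y

  δ : Fin n → Fin n → Fin n → Fin n → ℕ
  δ u v x y = indicator (x ≟ u) * indicator (y ≟ v)

  ∑∑-δ : ∀ u v → ∑∑ (δ u v) ≡ 1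
  ∑∑-δ u v = begin
    ∑[ x < n ] ∑[ y < n ] (indicator (x ≟ u) * indicator (y ≟ v))
      ≡⟨ sum-cong-≗ {n} (λ x → sym (*-distribˡ-sum {n} (indicator (x ≟ u)) (λ y → indicator (y ≟ v)))) ⟩
    ∑[ x < n ] (indicator (x ≟ u) * ∑[ y < n ] indicator (y ≟ v))
      ≡⟨ sum-cong-≗ {n} (λ x → cong (indicator (x ≟ u) *_) (∑-indicator v)) ⟩
    ∑[ x < n ] (indicator (x ≟ u) * 1)
      ≡⟨ sum-cong-≗ {n} (λ x → ℕ.*-identityʳ (indicator (x ≟ u))) ⟩
    ∑[ x < n ] indicator (x ≟ u)                                    ≡⟨ ∑-indicator u ⟩
    1                                                               ∎
    where open ≡-Reasoning

  δ-diag : ∀ {u v} → δ u v u v ≡ 1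
  δ-diag {u} {v} = cong₂ _*_ (indicator-yes (u ≟ u) refl) (indicator-yes (v ≟ v) refl)

  δ-off : ∀ {u v x y} → ¬ (x ≡ u × y ≡ v) → δ u v x y ≡ 0
  δ-off {u} {v} {x} {y} not-uv with x ≟ u
  ... | no x≢u = refl
  ... | yes refl = cong (1 *_) (indicator-no (y ≟ v) (not-uv ∘ (refl ,_)))

  ∑∑-+ : ∀ f g → ∑∑ (λ x y → f x y + g x y) ≡ ∑∑ f + ∑∑ g
  ∑∑-+ f g = trans (sum-cong-≗ λ x → ∑-distrib-+ (f x) (g x)) (∑-distrib-+ (λ x → sum (f x)) (λ x → sum (g x)))

  ∑∑-+δ : ∀ g u v → ∑∑ (λ x y → g x y + δ u v x y) ≡ suc (∑∑ g)
  ∑∑-+δ g u v = begin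
    ∑∑ (λ x y → g x y + δ u v x y)  ≡⟨ ∑∑-+ g (δ u v) ⟩
    ∑∑ g + ∑∑ (δ u v)               ≡⟨ cong (∑∑ g +_) (∑∑-δ u v) ⟩
    ∑∑ g + 1                        ≡⟨ ℕ.+-comm _ 1 ⟩
    suc (∑∑ g)                      ∎
    where open ≡-Reasoning

  ∑∑-≤-δ : ∀ {f g u v} → (∀ x y → f x y ≤ g x y + δ u v x y) → ∑∑ f ≤ suc (∑∑ g)
  ∑∑-≤-δ {g = g} {u} {v} f≤g+δ = ℕ.≤-trans (∑-mono-≤ λ x → ∑-mono-≤ (f≤g+δ x)) (ℕ.≤-reflexive (∑∑-+δ g u v))

  ∑∑-≡-δ : ∀ {f g u v} → (∀ x y → f x y ≡ g x y + δ u v x y) → ∑∑ f ≡ suc (∑∑ g)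
  ∑∑-≡-δ {g = g} {u} {v} f≡g+δ = trans (sum-cong-≗ λ x → sum-cong-≗ (f≡g+δ x)) (∑∑-+δ g u v)

module _ {A B : Set} where

  indicator-cong : (a? : Dec A) (b? : Dec B) → (A → B) → (B → A) → indicator a? ≡ indicator b?
  indicator-cong a? b? f g = cong (λ b → if b then 1 else 0) (does-⇔ (mk⇔ f g) a? b?)

  indicator-split : (a? : Dec A) (b? : Dec B) → indicator a? ≡ indicator (a? ×-dec b?) + indicator (a? ×-dec ¬? b?)
  indicator-split (yes a) (yes b) = refl
  indicator-split (yes a) (no ¬b) = refl
  indicator-split (no ¬a) b? = refl

module _ {n : ℕ} {_≺_ : Rel (Fin n) 0ℓ} (_≺?_ : Decidable _≺_) where

  inversions : Word n → ℕ
  inversions W = ∑∑ λ x y → indicator (Above? W x y ×-dec y ≺? x)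

  inversion≤inversions : ∀ {W x y} → Above W x y → y ≺ x → 1 ≤ inversions W
  inversion≤inversions {W} {x} {y} Wxy y≺x = begin
    1                                                 ≡⟨ sym (indicator-yes (Above? W x y ×-dec y ≺? x) (Wxy , y≺x)) ⟩
    indicator (Above? W x y ×-dec y ≺? x)             ≤⟨ term≤∑ (λ y → indicator (Above? W x y ×-dec y ≺? x)) y ⟩
    ∑[ y < n ] indicator (Above? W x y ×-dec y ≺? x)  ≤⟨ term≤∑ (λ x → ∑[ y < n ] indicator (Above? W x y ×-dec y ≺? x)) x ⟩
    inversions W                                      ∎
    where open ℕ.≤-Reasoning

  inversions≡0 : ∀ {W x y} → inversions W ≡ 0 → Above W x y → ¬ y ≺ x
  inversions≡0 {W} none Wxy y≺x = contradiction (ℕ.≤-trans (inversion≤inversions {W} Wxy y≺x) (ℕ.≤-reflexive none)) λ ()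

  inversions-alike : ∀ {R S i j} → AlikeAt i j R S → inversions R ≤ suc (inversions S)
  inversions-alike {R} {S} {i} {j} al = ∑∑-≤-δ pointwise
    where
    u = lookup R i
    v = lookup R j
    pointwise : ∀ x y → indicator (Above? R x y ×-dec y ≺? x) ≤ indicator (Above? S x y ×-dec y ≺? x) + δ u v x y
    pointwise x y = by-cases (Above? R x y ×-dec y ≺? x) ((x ≟ u) ×-dec (y ≟ v))
      where
      by-cases : (r : Dec (Above R x y × y ≺ x)) → Dec (x ≡ u × y ≡ v) →
                 indicator r ≤ indicator (Above? S x y ×-dec y ≺? x) + δ u v x y
      by-cases (no _) _ = z≤n
      by-cases (yes _) (yes (refl , refl)) = ℕ.≤-trans (ℕ.≤-reflexive (sym (δ-diag {u = x} {y}))) (ℕ.m≤n+m _ _)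
      by-cases (yes (Rxy , y≺x)) (no not-uv) =
        ℕ.≤-trans (ℕ.≤-reflexive (sym (indicator-yes (Above? S x y ×-dec y ≺? x) (Above-alikeAt al Rxy not-uv , y≺x)))) (ℕ.m≤m+n _ _)

  inversions-swap : ∀ {R S i j} → Linear S → Asymmetric _≺_ → AlikeAt i j R S →
                    lookup R j ≺ lookup R i → inversions R ≡ suc (inversions S)
  inversions-swap {R} {S} {i} {j} linS asym al v≺u = ∑∑-≡-δ pointwise
    where
    u = lookup R i
    v = lookup R j
    pointwise : ∀ x y → indicator (Above? R x y ×-dec y ≺? x) ≡ indicator (Above? S x y ×-dec y ≺? x) + δ u v x y
    pointwise x y = by-cases ((x ≟ u) ×-dec (y ≟ v))
      where
      by-cases : Dec (x ≡ u × y ≡ v) → indicator (Above? R x y ×-dec y ≺? x) ≡ indicator (Above? S x y ×-dec y ≺? x) + δ u v x y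
      by-cases (yes (refl , refl)) = trans (indicator-yes (Above? R u v ×-dec v ≺? u) (Above-before al , v≺u))
        (sym (cong₂ _+_ (indicator-no (Above? S u v ×-dec v ≺? u) (Above-asym linS (Above-after al) ∘ proj₁)) (δ-diag {u = u} {v})))
      by-cases (no not-uv) = trans (indicator-cong (Above? R x y ×-dec y ≺? x) (Above? S x y ×-dec y ≺? x) forth back)
        (sym (trans (cong (indicator (Above? S x y ×-dec y ≺? x) +_) (δ-off not-uv)) (ℕ.+-identityʳ _)))
        where
        forth : Above R x y × y ≺ x → Above S x y × y ≺ x
        forth (Rxy , y≺x) = Above-alikeAt al Rxy not-uv , y≺x
        back : Above S x y × y ≺ x → Above R x y × y ≺ x
        back (Sxy , y≺x) = Above-alikeAt (AlikeAt-sym al) Sxy not-vu , y≺x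
          where
          not-vu : ¬ (x ≡ lookup S i × y ≡ lookup S j)
          not-vu (refl , refl) = asym v≺u (subst₂ _≺_ (AlikeAt.swappedʳ al) (AlikeAt.swappedˡ al) y≺x)

  ascending : Transitive _≺_ → ∀ {W} → (∀ {i j} → toℕ j ≡ suc (toℕ i) → lookup W i ≺ lookup W j) →
              ∀ {x y} → Above W x y → x ≺ y
  ascending trans′ {W} up (p , q , refl , refl , p<q) with ℕ.m≤n⇒∃[o]m+o≡n p<q
  ... | d , p+d≡q = chain d (sym p+d≡q)
    where
    chain : ∀ d {q} → toℕ q ≡ suc (toℕ p + d) → lookup W p ≺ lookup W q
    chain zero q≡ = up (trans q≡ (cong suc (ℕ.+-identityʳ _)))
    chain (suc d) {q} q≡ = trans′ (chain d (toℕ-fromℕ< r<n)) (up (trans q≡′ (cong suc (sym (toℕ-fromℕ< r<n)))))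
      where
      q≡′ : toℕ q ≡ suc (suc (toℕ p + d))
      q≡′ = trans q≡ (cong suc (ℕ.+-suc _ d))
      r<n : suc (toℕ p + d) < n
      r<n = ℕ.<-trans (subst (suc (toℕ p + d) <_) (sym q≡′) ℕ.≤-refl) (toℕ<n q)

  adjacent-inversion : IsStrictTotalOrder _≡_ _≺_ → ∀ {W} → Linear W → 1 ≤ inversions W →
                       ∃₂ λ i j → toℕ j ≡ suc (toℕ i) × lookup W j ≺ lookup W i
  adjacent-inversion sto {W} lin 1≤inv
    with any? (λ i → any? (λ j → (toℕ j ℕ.≟ suc (toℕ i)) ×-dec (lookup W j ≺? lookup W i)))
  ... | yes found = found
  ... | no none = contradiction (ℕ.≤-trans 1≤inv (ℕ.≤-reflexive no-inversions)) λ ()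
    where
    open IsStrictTotalOrder sto using (compare; asym) renaming (trans to ≺-trans)
    up : ∀ {i j} → toℕ j ≡ suc (toℕ i) → lookup W i ≺ lookup W j
    up {i} {j} adj with compare (lookup W i) (lookup W j)
    ... | tri< Wi≺Wj _ _ = Wi≺Wj
    ... | tri≈ _ Wi≡Wj _ = contradiction (injective lin Wi≡Wj) (<⇒≢ (adjacent⇒< adj))
    ... | tri> _ _ Wj≺Wi = contradiction (i , j , adj , Wj≺Wi) none
    no-inversions : inversions W ≡ 0
    no-inversions = ∑-zero λ x → ∑-zero λ y → indicator-no (Above? W x y ×-dec y ≺? x)
      λ (Wxy , y≺x) → asym (ascending ≺-trans {W} up Wxy) y≺x

sortedWord : {_≺_ : Rel (Fin n) 0ℓ} → IsStrictTotalOrder _≡_ _≺_ →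
             ∃ λ W → Linear W × (∀ {x y} → Above W x y → x ≺ y)
sortedWord {n} {_≺_} sto = sort _ (allFin n) (linear allFin-injective) refl
  where
  open IsStrictTotalOrder sto using (_<?_; compare; asym)
  allFin-injective : IsLinearOrder (allFin n)
  allFin-injective {i} {j} eq = trans (sym (lookup-allFin i)) (trans eq (lookup-allFin j))
  sort : ∀ m W → Linear W → inversions _<?_ W ≡ m → ∃ λ W → Linear W × (∀ {x y} → Above W x y → x ≺ y)
  sort zero W lin sorted = W , lin , ordered
    where
    ordered : ∀ {x y} → Above W x y → x ≺ y
    ordered {x} {y} Wxy with compare x y
    ... | tri< x≺y _ _ = x≺y
    ... | tri≈ _ refl _ = contradiction Wxy (Above-irrefl lin refl)
    ... | tri> _ _ y≺x = contradiction y≺x (inversions≡0 _<?_ {W} sorted Wxy)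
  sort (suc m) W lin inv≡1+m with adjacent-inversion _<?_ sto lin (ℕ.≤-trans (s≤s z≤n) (ℕ.≤-reflexive (sym inv≡1+m)))
  ... | i , j , adj , Wj≺Wi = sort m (swap W i j) (swap-linear lin)
          (ℕ.suc-injective (trans (sym (inversions-swap _<?_ (swap-linear lin) asym (swap-alikeAt {R = W} adj) Wj≺Wi)) inv≡1+m))

distance : Word n → Word n → ℕ
distance R T = inversions (Above? T) R

module _ {R T : Word n} (linR : Linear R) (linT : Linear T) where

  distance≡0⇒≡ : distance R T ≡ 0 → R ≡ T
  distance≡0⇒≡ none = ≡-from-Above linR linT λ {x} {y} Rxy →
    Above-flip linT (λ { refl → Above-irrefl linR refl Rxy }) (inversions≡0 (Above? T) {R} none Rxy)

  -- a pair ordered oppositely by R and T is ordered oppositely by exactly one of (R, M) and (M, T)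
  distance-between : ∀ {M} → Linear M → (∀ {x y} → Above R x y → Above T x y → Above M x y) →
                     distance R T ≡ distance R M + distance M T
  distance-between {M} linM between = trans (sum-cong-≗ λ x → sum-cong-≗ (pointwise x))
    (∑∑-+ (λ x y → indicator (Above? R x y ×-dec Above? M y x)) (λ x y → indicator (Above? M x y ×-dec Above? T y x)))
    where
    pointwise : ∀ x y → indicator (Above? R x y ×-dec Above? T y x)
                      ≡ indicator (Above? R x y ×-dec Above? M y x) + indicator (Above? M x y ×-dec Above? T y x)
    pointwise x y = trans (indicator-split RT (Above? M y x))
      (cong₂ _+_ (indicator-cong (RT ×-dec Above? M y x) (Above? R x y ×-dec Above? M y x) drop-T restore-T)
                 (indicator-cong (RT ×-dec ¬? (Above? M y x)) (Above? M x y ×-dec Above? T y x) to-M from-M))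
      where
      RT = Above? R x y ×-dec Above? T y x
      x≢y : Above R x y → x ≢ y
      x≢y Rxy refl = Above-irrefl linR refl Rxy
      drop-T : (Above R x y × Above T y x) × Above M y x → Above R x y × Above M y x
      drop-T ((Rxy , _) , Myx) = Rxy , Myx
      restore-T : Above R x y × Above M y x → (Above R x y × Above T y x) × Above M y x
      restore-T (Rxy , Myx) = (Rxy , Above-flip linT (x≢y Rxy) λ Txy → Above-asym linM (between Rxy Txy) Myx) , Myx
      to-M : (Above R x y × Above T y x) × ¬ Above M y x → Above M x y × Above T y x
      to-M ((Rxy , Tyx) , ¬Myx) = Above-flip linM (x≢y Rxy ∘ sym) ¬Myx , Tyx
      from-M : Above M x y × Above T y x → (Above R x y × Above T y x) × ¬ Above M y x
      from-M (Mxy , Tyx) = (R-xy , Tyx) , Above-asym linM Mxy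
        where R-xy = Above-flip linR (λ y≡x → Above-irrefl linM (sym y≡x) Mxy) λ Ryx → Above-asym linM Mxy (between Ryx Tyx)

distance-self : {R : Word n} → Linear R → distance R R ≡ 0
distance-self {n} {R} lin = ∑-zero {n} λ x → ∑-zero {n} λ y →
  indicator-no (Above? R x y ×-dec Above? R y x) λ (Rxy , Ryx) → Above-asym lin Rxy Ryx

_++ₚ_ : ∀ {P : Domain n} {R M T a k} → PathIn P R M (suc a) → PathIn P M T k → PathIn P R T (a + k)
single _ ++ₚ q = q
_++ₚ_ {a = suc a} (step pR alike p) q = step pR alike (p ++ₚ q)

path-length : ∀ {R T : Word n} {k} → PathIn IsLinearOrder R T k → suc (distance R T) ≤ k
path-length {R = R} (single linR) = ℕ.≤-reflexive (cong suc (distance-self {R = R} (linear linR)))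
path-length {R = R} {T} (step {S = S} _ alike path) with alike⇒alikeAt {R = R} {S} alike
... | _ , _ , al = s≤s (ℕ.≤-trans (inversions-alike (Above? T) al) (path-length path))

-- Orders of three letters

record Finite (X : Set) : Set where
  field
    elements : List X
    complete : ∀ x → x ∈ elements

open Finite ⦃ ... ⦄

module _ {X : Set} ⦃ _ : Finite X ⦄ {P : X → Set} where

  ∀? : (∀ x → Dec (P x)) → Dec (∀ x → P x)
  ∀? P? = map′ (λ ps x → All.lookup ps (complete x)) (λ ps → All.tabulate λ {x} _ → ps x) (All.all? P? elements)

  ∃? : (∀ x → Dec (P x)) → Dec (∃ P)
  ∃? P? = map′ satisfied (λ (x , px) → lose (complete x) px) (Any.any? P? elements)

instance
  Bool-finite : Finite Bool
  Bool-finite = record { elements = true ∷ false ∷ [] ; complete = λ { true → here refl ; false → there (here refl) } }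

  Pos-finite : Finite Pos
  Pos-finite = record
    { elements = p1 ∷ p2 ∷ p3 ∷ []
    ; complete = λ { p1 → here refl ; p2 → there (here refl) ; p3 → there (there (here refl)) }
    }

data Letter : Set where
  A B C : Letter

_≟ₗ_ : DecidableEquality Letter
A ≟ₗ A = yes refl
A ≟ₗ B = no λ ()
A ≟ₗ C = no λ ()
B ≟ₗ A = no λ ()
B ≟ₗ B = yes refl
B ≟ₗ C = no λ ()
C ≟ₗ A = no λ ()
C ≟ₗ B = no λ ()
C ≟ₗ C = yes refl

instance
  Letter-finite : Finite Letter
  Letter-finite = record
    { elements = A ∷ B ∷ C ∷ []
    ; complete = λ { A → here refl ; B → there (here refl) ; C → there (there (here refl)) }
    }

data Pattern : Set where
  ABC ACB BAC BCA CAB CBA : Pattern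

instance
  Pattern-finite : Finite Pattern
  Pattern-finite = record
    { elements = ABC ∷ ACB ∷ BAC ∷ BCA ∷ CAB ∷ CBA ∷ []
    ; complete = λ
      { ABC → here refl
      ; ACB → there (here refl)
      ; BAC → there (there (here refl))
      ; BCA → there (there (there (here refl)))
      ; CAB → there (there (there (there (here refl))))
      ; CBA → there (there (there (there (there (here refl)))))
      }
    }

first second third : Pattern → Letter
first ABC = A
first ACB = A
first BAC = B
first BCA = B
first CAB = C
first CBA = C
second ABC = B
second ACB = C
second BAC = A
second BCA = C
second CAB = A
second CBA = B
third ABC = C
third ACB = B
third BAC = C
third BCA = A
third CAB = B
third CBA = A

_at_ : Pattern → Pos → Letter
σ at k = select k (first σ) (second σ) (third σ)

rank : Pattern → Letter → ℕ
rank σ x with x ≟ₗ first σ | x ≟ₗ second σ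
... | yes _ | _ = 0
... | no _ | yes _ = 1
... | no _ | no _ = 2

before : Pattern → Letter → Letter → Bool
before σ x y = rank σ x <ᵇ rank σ y

Avoids : Letter → Pos → Pattern → Set
Avoids l k σ = σ at k ≢ l

Avoids? : ∀ l k σ → Dec (Avoids l k σ)
Avoids? l k σ = ¬? ((σ at k) ≟ₗ l)

Before : Pattern → Letter → Letter → Set
Before σ x y = before σ x y ≡ true

Before? : ∀ σ x y → Dec (Before σ x y)
Before? σ x y = before σ x y ≟ᵇ true

before-trans : ∀ σ x y z → Before σ x y → Before σ y z → Before σ x z
before-trans = from-yes (∀? λ σ → ∀? λ x → ∀? λ y → ∀? λ z → Before? σ x y →-dec Before? σ y z →-dec Before? σ x z)

before-irrefl : ∀ σ x → before σ x x ≡ false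
before-irrefl = from-yes (∀? λ σ → ∀? λ x → before σ x x ≟ᵇ false)

before-flip : ∀ σ x y → x ≢ y → before σ y x ≡ not (before σ x y)
before-flip = from-yes (∀? λ σ → ∀? λ x → ∀? λ y → ¬? (x ≟ₗ y) →-dec (before σ y x ≟ᵇ not (before σ x y)))

first-second-third : ∀ σ → Before σ (first σ) (second σ) × Before σ (second σ) (third σ)
first-second-third = from-yes (∀? λ σ → Before? σ (first σ) (second σ) ×-dec Before? σ (second σ) (third σ))

at-from-Before : ∀ τ σ → Before τ (first σ) (second σ) → Before τ (second σ) (third σ) → ∀ k → τ at k ≡ σ at k
at-from-Before = from-yes (∀? λ τ → ∀? λ σ → Before? τ (first σ) (second σ) →-dec Before? τ (second σ) (third σ) →-dec
                             ∀? λ k → (τ at k) ≟ₗ (σ at k))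

first-avoids-bottom : ∀ σ → Avoids (first σ) p3 σ
first-avoids-bottom = from-yes (∀? λ σ → Avoids? (first σ) p3 σ)

fromBefore : Bool → Bool → Bool → Pattern
fromBefore true  true  _     = ABC
fromBefore true  false true  = ACB
fromBefore true  false false = CAB
fromBefore false true  true  = BAC
fromBefore false true  false = BCA
fromBefore false false _     = CBA

maj : Bool → Bool → Bool → Bool
maj a b c = (a ∧ b) ∨ (b ∧ c) ∨ (a ∧ c)

majority : Pattern → Pattern → Pattern → Pattern
majority σ τ υ = fromBefore (m A B) (m B C) (m A C)
  where m : Letter → Letter → Bool
        m x y = maj (before σ x y) (before τ x y) (before υ x y)

-- three orders sharing a never-condition have an acyclic majority relation, which shares it too
majority-avoids : ∀ l k σ τ υ → Avoids l k σ → Avoids l k τ → Avoids l k υ →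
                  Avoids l k (majority σ τ υ) × (∀ x y → before (majority σ τ υ) x y ≡ maj (before σ x y) (before τ x y) (before υ x y))
majority-avoids = from-yes (∀? λ l → ∀? λ k → ∀? λ σ → ∀? λ τ → ∀? λ υ →
  Avoids? l k σ →-dec Avoids? l k τ →-dec Avoids? l k υ →-dec
  Avoids? l k (majority σ τ υ) ×-dec
  (∀? λ x → ∀? λ y → before (majority σ τ υ) x y ≟ᵇ maj (before σ x y) (before τ x y) (before υ x y)))

_≟ₚ_ : DecidableEquality Pos
p1 ≟ₚ p1 = yes refl
p1 ≟ₚ p2 = no λ ()
p1 ≟ₚ p3 = no λ ()
p2 ≟ₚ p1 = no λ ()
p2 ≟ₚ p2 = yes refl
p2 ≟ₚ p3 = no λ ()
p3 ≟ₚ p1 = no λ ()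
p3 ≟ₚ p2 = no λ ()
p3 ≟ₚ p3 = yes refl

SamePair : Letter → Letter → Letter → Letter → Set
SamePair p q x y = (x ≡ p × y ≡ q) ⊎ (x ≡ q × y ≡ p)

SamePair? : ∀ p q x y → Dec (SamePair p q x y)
SamePair? p q x y = ((x ≟ₗ p) ×-dec (y ≟ₗ q)) ⊎-dec ((x ≟ₗ q) ×-dec (y ≟ₗ p))

StepToward : Letter → Letter → Pattern → Pattern → Pattern → Set
StepToward p q R S T = (∀ x y → ¬ SamePair p q x y → before S x y ≡ before R x y) × before S p q ≡ before T p q

StepToward? : ∀ p q R S T → Dec (StepToward p q R S T)
StepToward? p q R S T =
  (∀? λ x → ∀? λ y → ¬? (SamePair? p q x y) →-dec (before S x y ≟ᵇ before R x y)) ×-dec (before S p q ≟ᵇ before T p q)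

Between : Pattern → Pattern → Pattern → Set
Between R T σ = (∃₂ λ x y → Before R x y × Before T y x × Before σ x y) × (∃₂ λ x y → Before R x y × Before T y x × Before σ y x)

Between? : ∀ R T σ → Dec (Between R T σ)
Between? R T σ = (∃? λ x → ∃? λ y → Before? R x y ×-dec Before? T y x ×-dec Before? σ x y)
          ×-dec (∃? λ x → ∃? λ y → Before? R x y ×-dec Before? T y x ×-dec Before? σ y x)

-- The combinatorial core of (i) ⇒ (ii); it fails for never-middle conditions (k₀ = p2).
stepToward-avoids : ∀ l₀ k₀ p q R S T → k₀ ≢ p2 → Avoids l₀ k₀ R → Avoids l₀ k₀ T → StepToward p q R S T →
         ∃₂ λ l k → Avoids l k S × (∀ σ → Avoids l₀ k₀ σ → ¬ Between R T σ → Avoids l k σ)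
stepToward-avoids = from-yes (∀? λ l₀ → ∀? λ k₀ → ∀? λ p → ∀? λ q → ∀? λ R → ∀? λ S → ∀? λ T →
  ¬? (k₀ ≟ₚ p2) →-dec Avoids? l₀ k₀ R →-dec Avoids? l₀ k₀ T →-dec StepToward? p q R S T →-dec
  (∃? λ l → ∃? λ k → Avoids? l k S ×-dec (∀? λ σ → Avoids? l₀ k₀ σ →-dec ¬? (Between? R T σ) →-dec Avoids? l k σ)))

top-stable : ∀ l p q R S → StepToward p q R S S → Avoids l p2 R → Avoids l p2 S → first R ≡ l → first S ≡ l
top-stable = from-yes (∀? λ l → ∀? λ p → ∀? λ q → ∀? λ R → ∀? λ S →
  StepToward? p q R S S →-dec Avoids? l p2 R →-dec Avoids? l p2 S →-dec (first R ≟ₗ l) →-dec (first S ≟ₗ l))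

maj-not : ∀ a b c → maj (not a) (not b) (not c) ≡ not (maj a b c)
maj-not = from-yes (∀? λ a → ∀? λ b → ∀? λ c → maj (not a) (not b) (not c) ≟ᵇ not (maj a b c))

between-majority : ∀ l k R T σ → Avoids l k R → Avoids l k T → Avoids l k σ → Between R T σ → Between R T (majority R T σ)
between-majority = from-yes (∀? λ l → ∀? λ k → ∀? λ R → ∀? λ T → ∀? λ σ →
  Avoids? l k R →-dec Avoids? l k T →-dec Avoids? l k σ →-dec Between? R T σ →-dec Between? R T (majority R T σ))

-- Restriction to a triple

does-Above-flip : {W : Word n} → Linear W → ∀ {x y} → x ≢ y → does (Above? W y x) ≡ not (does (Above? W x y))
does-Above-flip {W = W} lin {x} {y} x≢y with Above? W x y
... | yes Wxy = dec-false (Above? W y x) (Above-asym lin Wxy)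
... | no ¬Wxy = dec-true (Above? W y x) (Above-flip lin x≢y ¬Wxy)

from-does : {P : Set} {d : Dec P} → does d ≡ true → P
from-does {d = yes p} _ = p

module _ {n} (a b c : Fin n) where

  label : Letter → Fin n
  label A = a
  label B = b
  label C = c

  restrict : Word n → Pattern
  restrict W = fromBefore (does (Above? W a b)) (does (Above? W b c)) (does (Above? W a c))

  module _ (distinct : Distinct3 a b c) where

    private
      a≢b = proj₁ distinct
      a≢c = proj₁ (proj₂ distinct)
      b≢c = proj₂ (proj₂ distinct)

    label-injective : ∀ {x y} → label x ≡ label y → x ≡ y
    label-injective {A} {A} _ = refl
    label-injective {A} {B} e = contradiction e a≢b
    label-injective {A} {C} e = contradiction e a≢c
    label-injective {B} {A} e = contradiction (sym e) a≢b
    label-injective {B} {B} _ = refl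
    label-injective {B} {C} e = contradiction e b≢c
    label-injective {C} {A} e = contradiction (sym e) a≢c
    label-injective {C} {B} e = contradiction (sym e) b≢c
    label-injective {C} {C} _ = refl

    module _ {W : Word n} (lin : Linear W) where

      private
        σ = restrict W

        basic : before σ A B ≡ does (Above? W a b) × before σ B C ≡ does (Above? W b c) × before σ A C ≡ does (Above? W a c)
        basic = by-cases (Above? W a b) (Above? W b c) (Above? W a c)
          where
          by-cases : (ab : Dec (Above W a b)) (bc : Dec (Above W b c)) (ac : Dec (Above W a c)) →
                     let τ = fromBefore (does ab) (does bc) (does ac) in
                     before τ A B ≡ does ab × before τ B C ≡ does bc × before τ A C ≡ does ac
          by-cases (yes _) (yes _) (yes _) = refl , refl , refl
          by-cases (yes Wab) (yes Wbc) (no ¬Wac) = contradiction (Above-trans lin Wab Wbc) ¬Wac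
          by-cases (yes _) (no _) (yes _) = refl , refl , refl
          by-cases (yes _) (no _) (no _) = refl , refl , refl
          by-cases (no _) (yes _) (yes _) = refl , refl , refl
          by-cases (no _) (yes _) (no _) = refl , refl , refl
          by-cases (no ¬Wab) (no ¬Wbc) (yes Wac) =
            contradiction (Above-trans lin (Above-flip lin b≢c ¬Wbc) (Above-flip lin a≢b ¬Wab)) (Above-asym lin Wac)
          by-cases (no _) (no _) (no _) = refl , refl , refl

        diagonal : ∀ x → before σ x x ≡ does (Above? W (label x) (label x))
        diagonal x = trans (before-irrefl σ x) (sym (dec-false (Above? W (label x) (label x)) (Above-irrefl lin refl)))

        flipped : ∀ x y → x ≢ y → before σ x y ≡ does (Above? W (label x) (label y)) →
                  before σ y x ≡ does (Above? W (label y) (label x))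
        flipped x y x≢y e = trans (before-flip σ x y x≢y) (trans (cong not e) (sym (does-Above-flip lin (x≢y ∘ label-injective))))

      before-restrict : ∀ x y → before (restrict W) x y ≡ does (Above? W (label x) (label y))
      before-restrict A A = diagonal A
      before-restrict A B = proj₁ basic
      before-restrict A C = proj₂ (proj₂ basic)
      before-restrict B A = flipped A B (λ ()) (proj₁ basic)
      before-restrict B B = diagonal B
      before-restrict B C = proj₁ (proj₂ basic)
      before-restrict C A = flipped A C (λ ()) (proj₂ (proj₂ basic))
      before-restrict C B = flipped B C (λ ()) (proj₁ (proj₂ basic))
      before-restrict C C = diagonal C

      Before⇔Above : ∀ x y → Before (restrict W) x y ⇔ Above W (label x) (label y)
      Before⇔Above x y = mk⇔
        (λ Bxy → from-does {d = Above? W (label x) (label y)} (trans (sym (before-restrict x y)) Bxy))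
        (λ Wxy → trans (before-restrict x y) (dec-true (Above? W (label x) (label y)) Wxy))

    letter-of : ∀ {x} → InTriple a b c x → ∃ λ l → label l ≡ x
    letter-of (inj₁ refl) = A , refl
    letter-of (inj₂ (inj₁ refl)) = B , refl
    letter-of (inj₂ (inj₂ refl)) = C , refl

    label-inTriple : ∀ l → InTriple a b c (label l)
    label-inTriple A = inj₁ refl
    label-inTriple B = inj₂ (inj₁ refl)
    label-inTriple C = inj₂ (inj₂ refl)

    private
      select-label : ∀ k x y z → select k (label x) (label y) (label z) ≡ label (select k x y z)
      select-label p1 _ _ _ = refl
      select-label p2 _ _ _ = refl
      select-label p3 _ _ _ = refl

      arrangement : ∀ σ → Arrangement a b c (label (first σ)) (label (second σ)) (label (third σ))
      arrangement ABC = inj₁ (refl , refl , refl)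
      arrangement ACB = inj₂ (inj₁ (refl , refl , refl))
      arrangement BAC = inj₂ (inj₂ (inj₁ (refl , refl , refl)))
      arrangement BCA = inj₂ (inj₂ (inj₂ (inj₁ (refl , refl , refl))))
      arrangement CAB = inj₂ (inj₂ (inj₂ (inj₂ (inj₁ (refl , refl , refl)))))
      arrangement CBA = inj₂ (inj₂ (inj₂ (inj₂ (inj₂ (refl , refl , refl)))))

      pattern-of : ∀ {x₁ x₂ x₃} → Arrangement a b c x₁ x₂ x₃ →
                   ∃ λ σ → x₁ ≡ label (first σ) × x₂ ≡ label (second σ) × x₃ ≡ label (third σ)
      pattern-of (inj₁ eqs) = ABC , eqs
      pattern-of (inj₂ (inj₁ eqs)) = ACB , eqs
      pattern-of (inj₂ (inj₂ (inj₁ eqs))) = BAC , eqs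
      pattern-of (inj₂ (inj₂ (inj₂ (inj₁ eqs)))) = BCA , eqs
      pattern-of (inj₂ (inj₂ (inj₂ (inj₂ (inj₁ eqs))))) = CAB , eqs
      pattern-of (inj₂ (inj₂ (inj₂ (inj₂ (inj₂ eqs))))) = CBA , eqs

    Never⇔Avoids : ∀ {D : Domain n} → IsDomain D → ∀ l k →
                   Never D a b c (label l) k ⇔ (∀ W → D W → Avoids l k (restrict W))
    Never⇔Avoids {D} isDom l k = mk⇔ forth back
      where
      forth : Never D a b c (label l) k → ∀ W → D W → Avoids l k (restrict W)
      forth never W dW σk≡l = never _ _ _ (arrangement σ , W , dW , above first-before-second , above second-before-third)
                                      (trans (select-label k (first σ) (second σ) (third σ)) (cong label σk≡l))
        where
        σ = restrict W
        above : ∀ {x y} → Before σ x y → Above W (label x) (label y)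
        above = Equivalence.to (Before⇔Above {W = W} (linear (isDom W dW)) _ _)
        first-before-second = proj₁ (first-second-third σ)
        second-before-third = proj₂ (first-second-third σ)
      back : (∀ W → D W → Avoids l k (restrict W)) → Never D a b c (label l) k
      back avoids x₁ x₂ x₃ (arr , R , dR , R₁₂ , R₂₃) xₖ≡l with pattern-of arr
      ... | τ , refl , refl , refl = avoids R dR (trans (at-from-Before (restrict R) τ (Before-of R₁₂) (Before-of R₂₃) k)
                                                 (label-injective (trans (sym (select-label k (first τ) (second τ) (third τ))) xₖ≡l)))
        where
        Before-of : ∀ {x y} → Above R (label x) (label y) → Before (restrict R) x y
        Before-of = Equivalence.from (Before⇔Above {W = R} (linear (isDom R dR)) _ _)

    restrict-alike : ∀ {R S : Word n} {i j} → Linear R → Linear S → AlikeAt i j R S → ∀ x y →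
                     ¬ (label x ≡ lookup R i × label y ≡ lookup R j) → ¬ (label x ≡ lookup R j × label y ≡ lookup R i) →
                     before (restrict S) x y ≡ before (restrict R) x y
    restrict-alike {R} {S} linR linS al x y not-ij not-ji = begin
      before (restrict S) x y              ≡⟨ before-restrict linS x y ⟩
      does (Above? S (label x) (label y))  ≡⟨ does-⇔ (mk⇔ back forth) (Above? S (label x) (label y)) (Above? R (label x) (label y)) ⟩
      does (Above? R (label x) (label y))  ≡⟨ before-restrict linR x y ⟨
      before (restrict R) x y              ∎
      where
      open ≡-Reasoning
      forth : Above R (label x) (label y) → Above S (label x) (label y)
      forth Rxy = Above-alikeAt al Rxy not-ij
      back : Above S (label x) (label y) → Above R (label x) (label y)
      back Sxy = Above-alikeAt (AlikeAt-sym al) Sxy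
        λ (x≡Si , y≡Sj) → not-ji (trans x≡Si (AlikeAt.swappedˡ al) , trans y≡Sj (AlikeAt.swappedʳ al))

    -- p = q when the swapped pair does not lie in the triple
    restrict-step : ∀ {R S T : Word n} {i j} → Linear R → Linear S → Linear T → AlikeAt i j R S →
                    Above T (lookup R j) (lookup R i) → ∃₂ λ p q → StepToward p q (restrict R) (restrict S) (restrict T)
    restrict-step {R} {S} {T} {i} {j} linR linS linT al Tvu = by-cases (∃? λ p → label p ≟ u) (∃? λ q → label q ≟ v)
      where
      u = lookup R i
      v = lookup R j
      unchanged = restrict-alike linR linS al
      same-diagonal : before (restrict S) A A ≡ before (restrict T) A A
      same-diagonal = trans (before-irrefl (restrict S) A) (sym (before-irrefl (restrict T) A))
      by-cases : Dec (∃ λ p → label p ≡ u) → Dec (∃ λ q → label q ≡ v) →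
                 ∃₂ λ p q → StepToward p q (restrict R) (restrict S) (restrict T)
      by-cases (yes (p , p↦u)) (yes (q , q↦v)) = p , q , unchanged-off-pq , agree-on-pq
        where
        unchanged-off-pq : ∀ x y → ¬ SamePair p q x y → before (restrict S) x y ≡ before (restrict R) x y
        unchanged-off-pq x y not-pq = unchanged x y
          (λ (x≡u , y≡v) → not-pq (inj₁ (label-injective (trans x≡u (sym p↦u)) , label-injective (trans y≡v (sym q↦v)))))
          (λ (x≡v , y≡u) → not-pq (inj₂ (label-injective (trans x≡v (sym q↦v)) , label-injective (trans y≡u (sym p↦u)))))
        agree-on-pq : before (restrict S) p q ≡ before (restrict T) p q
        agree-on-pq = begin
          before (restrict S) p q              ≡⟨ before-restrict linS p q ⟩
          does (Above? S (label p) (label q))  ≡⟨ dec-false (Above? S _ _) (Above-asym linS (Above-after al) ∘ subst₂ (Above S) p↦u q↦v) ⟩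
          false                                ≡⟨ dec-false (Above? T _ _) (Above-asym linT Tvu ∘ subst₂ (Above T) p↦u q↦v) ⟨
          does (Above? T (label p) (label q))  ≡⟨ before-restrict linT p q ⟨
          before (restrict T) p q              ∎
          where open ≡-Reasoning
      by-cases (no ∄p) _ = A , A , (λ x y _ → unchanged x y (∄p ∘ (x ,_) ∘ proj₁) (∄p ∘ (y ,_) ∘ proj₂)) , same-diagonal
      by-cases _ (no ∄q) = A , A , (λ x y _ → unchanged x y (∄q ∘ (y ,_) ∘ proj₂) (∄q ∘ (x ,_) ∘ proj₁)) , same-diagonal

    strictly-between : ∀ {R M T : Word n} → Linear R → Linear M → Linear T →
                Between (restrict R) (restrict T) (restrict M) → 1 ≤ distance R M × 1 ≤ distance M T
    strictly-between {R} {M} {T} linR linM linT ((x , y , Rxy , Tyx , Mxy) , (x′ , y′ , Rx′y′ , _ , My′x′)) =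
      inversion≤inversions (Above? M) {R} (above linR x′ y′ Rx′y′) (above linM y′ x′ My′x′) ,
      inversion≤inversions (Above? T) {M} (above linM x y Mxy) (above linT y x Tyx)
      where
      above : ∀ {W} → Linear W → ∀ u v → Before (restrict W) u v → Above W (label u) (label v)
      above {W} lin u v = Equivalence.to (Before⇔Above {W = W} lin u v)

-- Maximal Condorcet domains

private
  cong₃ : {X Y Z V : Set} (f : X → Y → Z → V) {x x′ : X} {y y′ : Y} {z z′ : Z} →
          x ≡ x′ → y ≡ y′ → z ≡ z′ → f x y z ≡ f x′ y′ z′
  cong₃ f refl refl refl = refl

distinct? : (a b c : Fin n) → Dec (Distinct3 a b c)
distinct? a b c = ¬? (a ≟ b) ×-dec ¬? (a ≟ c) ×-dec ¬? (b ≟ c)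

module _ {D : Domain n} (maxCD : IsMaximalCondorcet D) where

  private
    isDom : IsDomain D
    isDom = proj₁ maxCD
    condorcet : IsCondorcet D
    condorcet = proj₁ (proj₂ maxCD)
    maximal = proj₂ (proj₂ maxCD)

    linear-member : ∀ {W} → D W → Linear W
    linear-member {W} dW = linear (isDom W dW)

  absorb : ∀ {W} → Linear W →
           (∀ a b c → Distinct3 a b c → ∃₂ λ l k → (∀ R → D R → Avoids l k (restrict a b c R)) × Avoids l k (restrict a b c W)) →
           D W
  absorb {W} linW shared = maximal D′ isDom′ condorcet′ (λ _ → inj₁) W (inj₂ refl)
    where
    D′ : Domain n
    D′ R = D R ⊎ R ≡ W
    isDom′ : IsDomain D′
    isDom′ R (inj₁ dR) = isDom R dR
    isDom′ R (inj₂ refl) = injective linW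
    condorcet′ : IsCondorcet D′
    condorcet′ a b c distinct with shared a b c distinct
    ... | l , k , avoidsD , avoidsW = label a b c l , k , label-inTriple a b c distinct l ,
      Equivalence.from (Never⇔Avoids a b c distinct isDom′ l k) λ where
        R (inj₁ dR) → avoidsD R dR
        R (inj₂ refl) → avoidsW

  never-pattern : ∀ a b c → Distinct3 a b c → ∃₂ λ l k → ∀ R → D R → Avoids l k (restrict a b c R)
  never-pattern a b c distinct with condorcet a b c distinct
  ... | x , k , x∈abc , never with letter-of a b c distinct x∈abc
  ...   | l , refl = l , k , Equivalence.to (Never⇔Avoids a b c distinct isDom l k) never

  private
    -- reading the condition off the decision of distinctness makes it independent of the distinctness proof
    FitsAt : Word n → ∀ a b c → Dec (Distinct3 a b c) → Set
    FitsAt W a b c (yes distinct) = let (l , k , _) = never-pattern a b c distinct in Avoids l k (restrict a b c W)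
    FitsAt W a b c (no _) = ⊤

    fitsAt? : ∀ W a b c d? → Dec (FitsAt W a b c d?)
    fitsAt? W a b c (yes distinct) = let (l , k , _) = never-pattern a b c distinct in Avoids? l k (restrict a b c W)
    fitsAt? W a b c (no _) = yes tt

    Fits : Word n → Set
    Fits W = ∀ a b c → FitsAt W a b c (distinct? a b c)

    member⇒fits : ∀ {W} → D W → Fits W
    member⇒fits {W} dW a b c with distinct? a b c
    ... | yes distinct = proj₂ (proj₂ (never-pattern a b c distinct)) W dW
    ... | no _ = tt

    fits⇒member : ∀ {W} → Linear W → Fits W → D W
    fits⇒member {W} linW fits = absorb linW shared
      where
      shared : ∀ a b c → Distinct3 a b c → ∃₂ λ l k → (∀ R → D R → Avoids l k (restrict a b c R)) × Avoids l k (restrict a b c W)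
      shared a b c distinct′ with distinct? a b c | fits a b c
      ... | yes distinct | avoidsW = let (l , k , avoidsD) = never-pattern a b c distinct in l , k , avoidsD , avoidsW
      ... | no indistinct | _ = contradiction distinct′ indistinct

  member? : ∀ W → Dec (D W)
  member? W with linear? W
  ... | no nonlinear = no (nonlinear ∘ linear ∘ isDom W)
  ... | yes linW = map′ (fits⇒member linW) member⇒fits
                       (all? λ a → all? λ b → all? λ c → fitsAt? W a b c (distinct? a b c))

  module _ {R T Q : Word n} (dR : D R) (dT : D T) (dQ : D Q) where

    private
      linR = linear-member dR
      linT = linear-member dT
      linQ = linear-member dQ

      majAbove : Fin n → Fin n → Bool
      majAbove x y = maj (does (Above? R x y)) (does (Above? T x y)) (does (Above? Q x y))

      MajAbove : Fin n → Fin n → Set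
      MajAbove x y = majAbove x y ≡ true

      majAbove-irrefl : ∀ x → majAbove x x ≡ false
      majAbove-irrefl x = cong₃ maj (no-loop linR) (no-loop linT) (no-loop linQ)
        where
        no-loop : ∀ {W} → Linear W → does (Above? W x x) ≡ false
        no-loop {W} lin = dec-false (Above? W x x) (Above-irrefl lin refl)

      majAbove-flip : ∀ {x y} → x ≢ y → majAbove y x ≡ not (majAbove x y)
      majAbove-flip {x} {y} x≢y = trans (cong₃ maj (does-Above-flip linR x≢y) (does-Above-flip linT x≢y) (does-Above-flip linQ x≢y))
        (maj-not (does (Above? R x y)) (does (Above? T x y)) (does (Above? Q x y)))

      majAbove-asym : ∀ {x y} → MajAbove x y → ¬ MajAbove y x
      majAbove-asym {x} {y} xy yx with x ≟ y
      ... | yes refl = contradiction (trans (sym xy) (majAbove-irrefl x)) λ ()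
      ... | no x≢y = contradiction (trans (sym yx) (trans (majAbove-flip x≢y) (cong not xy))) λ ()

      maj-restrict : ∀ {a b c} → Distinct3 a b c → ∀ u v →
        maj (before (restrict a b c R) u v) (before (restrict a b c T) u v) (before (restrict a b c Q) u v) ≡ majAbove (label a b c u) (label a b c v)
      maj-restrict {a} {b} {c} distinct u v =
        cong₃ maj (before-restrict a b c distinct linR u v) (before-restrict a b c distinct linT u v) (before-restrict a b c distinct linQ u v)

      before-majority : ∀ {a b c} → Distinct3 a b c → ∀ u v →
        before (majority (restrict a b c R) (restrict a b c T) (restrict a b c Q)) u v ≡ majAbove (label a b c u) (label a b c v)
      before-majority {a} {b} {c} distinct u v =
        let (l , k , avoids) = never-pattern a b c distinct in
        trans (proj₂ (majority-avoids l k _ _ _ (avoids R dR) (avoids T dT) (avoids Q dQ)) u v) (maj-restrict distinct u v)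

      majAbove-trans : ∀ {x y z} → MajAbove x y → MajAbove y z → MajAbove x z
      majAbove-trans {x} {y} {z} xy yz with x ≟ y | y ≟ z | x ≟ z
      ... | yes refl | _ | _ = contradiction xy (majAbove-asym xy)
      ... | _ | yes refl | _ = contradiction yz (majAbove-asym yz)
      ... | _ | _ | yes refl = contradiction yz (majAbove-asym xy)
      ... | no x≢y | no y≢z | no x≢z =
        trans (sym (before-majority distinct A C))
          (before-trans μ A B C (trans (before-majority distinct A B) xy) (trans (before-majority distinct B C) yz))
        where
        distinct : Distinct3 x y z
        distinct = x≢y , x≢z , y≢z
        μ = majority (restrict x y z R) (restrict x y z T) (restrict x y z Q)

      majAbove-connex : ∀ {x y} → x ≢ y → MajAbove x y ⊎ MajAbove y x
      majAbove-connex {x} {y} x≢y with majAbove x y in xy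
      ... | true = inj₁ refl
      ... | false = inj₂ (trans (majAbove-flip x≢y) (cong not xy))

    majority-word : ∃ λ M → D M × (∀ {x y} → Above R x y → Above T x y → Above M x y) ×
                    (∀ a b c → Distinct3 a b c → restrict a b c M ≡ majority (restrict a b c R) (restrict a b c T) (restrict a b c Q))
    majority-word = M , absorb linM shared , between , restrict-M
      where
      sorted = sortedWord (trans∧irr∧connex⇒isStrictTotalOrder (λ { refl xx → majAbove-asym xx xx }) majAbove-trans majAbove-connex)
      M = proj₁ sorted
      linM : Linear M
      linM = proj₁ (proj₂ sorted)
      does-Above : ∀ x y → does (Above? M x y) ≡ majAbove x y
      does-Above x y =
        trans (does-⇔ (mk⇔ (proj₂ (proj₂ sorted)) from-maj) (Above? M x y) (majAbove x y ≟ᵇ true)) (does-≟-true (majAbove x y))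
        where
        from-maj : MajAbove x y → Above M x y
        from-maj xy with x ≟ y
        ... | yes refl = contradiction xy (majAbove-asym xy)
        ... | no x≢y with Above-connex linM x≢y
        ...   | inj₁ Mxy = Mxy
        ...   | inj₂ Myx = contradiction (proj₂ (proj₂ sorted) Myx) (majAbove-asym xy)
        does-≟-true : ∀ b → does (b ≟ᵇ true) ≡ b
        does-≟-true true = refl
        does-≟-true false = refl
      between : ∀ {x y} → Above R x y → Above T x y → Above M x y
      between {x} {y} Rxy Txy = from-does {d = Above? M x y} (trans (does-Above x y)
        (cong₂ (λ r t → maj r t (does (Above? Q x y))) (dec-true (Above? R x y) Rxy) (dec-true (Above? T x y) Txy)))
      restrict-M : ∀ a b c → Distinct3 a b c → restrict a b c M ≡ majority (restrict a b c R) (restrict a b c T) (restrict a b c Q)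
      restrict-M a b c distinct = cong₃ fromBefore (majority-pair A B) (majority-pair B C) (majority-pair A C)
        where
        majority-pair : ∀ u v → does (Above? M (label a b c u) (label a b c v)) ≡
                                maj (before (restrict a b c R) u v) (before (restrict a b c T) u v) (before (restrict a b c Q) u v)
        majority-pair u v = trans (does-Above _ _) (sym (maj-restrict distinct u v))
      shared : ∀ a b c → Distinct3 a b c → ∃₂ λ l k → (∀ W → D W → Avoids l k (restrict a b c W)) × Avoids l k (restrict a b c M)
      shared a b c distinct =
        let (l , k , avoids) = never-pattern a b c distinct
        in l , k , avoids , subst (Avoids l k) (sym (restrict-M a b c distinct))
                              (proj₁ (majority-avoids l k _ _ _ (avoids R dR) (avoids T dT) (avoids Q dQ)))

  module _ (peakPit : IsPeakPit D) where

    peak-pit-pattern : ∀ a b c → Distinct3 a b c → ∃₂ λ l k → k ≢ p2 × ∀ R → D R → Avoids l k (restrict a b c R)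
    peak-pit-pattern a b c distinct with peakPit a b c distinct
    ... | x , x∈abc , never with letter-of a b c distinct x∈abc
    ...   | l , refl with never
    ...     | inj₁ never-top = l , p1 , (λ ()) , Equivalence.to (Never⇔Avoids a b c distinct isDom l p1) never-top
    ...     | inj₂ never-bottom = l , p3 , (λ ()) , Equivalence.to (Never⇔Avoids a b c distinct isDom l p3) never-bottom

    Intermediate : Word n → Word n → Set
    Intermediate R T = ∃ λ a → ∃ λ b → ∃ λ c → Distinct3 a b c ×
                       ∃ λ Q → D Q × Between (restrict a b c R) (restrict a b c T) (restrict a b c Q)

    intermediate? : ∀ R T → Dec (Intermediate R T)
    intermediate? R T = any? λ a → any? λ b → any? λ c → distinct? a b c ×-dec
      ∃-word? λ Q → member? Q ×-dec Between? (restrict a b c R) (restrict a b c T) (restrict a b c Q)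

    swap-member : ∀ {R T i j} → D R → D T → (adj : toℕ j ≡ suc (toℕ i)) → Above T (lookup R j) (lookup R i) →
                  ¬ Intermediate R T → D (swap R i j)
    swap-member {R} {T} {i} {j} dR dT adj Tji none = absorb linS shared
      where
      linS = swap-linear (linear-member dR)
      shared : ∀ a b c → Distinct3 a b c →
               ∃₂ λ l k → (∀ W → D W → Avoids l k (restrict a b c W)) × Avoids l k (restrict a b c (swap R i j))
      shared a b c distinct =
        let (l₀ , k₀ , k₀≢p2 , avoids) = peak-pit-pattern a b c distinct
            (p , q , toward) = restrict-step a b c distinct (linear-member dR) linS (linear-member dT) (swap-alikeAt {R = R} adj) Tji
            (l , k , avoidsS , others) = stepToward-avoids l₀ k₀ p q _ _ _ k₀≢p2 (avoids R dR) (avoids T dT) toward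
        in l , k , (λ W dW → others (restrict a b c W) (avoids W dW) λ btw → none (a , b , c , distinct , W , dW , btw)) , avoidsS

    majority-detour : ∀ {R T} → D R → D T → Intermediate R T →
             ∃ λ M → D M × distance R T ≡ distance R M + distance M T × 1 ≤ distance R M × 1 ≤ distance M T
    majority-detour {R} {T} dR dT (a , b , c , distinct , Q , dQ , btw) =
      let (M , dM , between , restrict-M) = majority-word dR dT dQ
          (l , k , avoids) = never-pattern a b c distinct
      in M , dM , distance-between (linear-member dR) (linear-member dT) (linear-member dM) between ,
         strictly-between a b c distinct (linear-member dR) (linear-member dM) (linear-member dT)
           (subst (Between (restrict a b c R) (restrict a b c T)) (sym (restrict-M a b c distinct))
             (between-majority l k (restrict a b c R) (restrict a b c T) (restrict a b c Q) (avoids R dR) (avoids T dT) (avoids Q dQ) btw))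

    geodesic : ∀ {R T} → D R → D T → ∀ {d} → distance R T ≡ d → Acc _<_ d → PathIn D R T (suc d)
    geodesic {R} {T} dR dT {zero} d≡0 _ =
      subst (λ W → PathIn D R W 1) (distance≡0⇒≡ (linear-member dR) (linear-member dT) d≡0) (single dR)
    geodesic {R} {T} dR dT {suc m} d≡ (acc smaller) =
      let (i , j , adj , Tji) = adjacent-inversion (Above? T) (Above-isStrictTotalOrder linT) linR
                                  (ℕ.≤-trans (s≤s z≤n) (ℕ.≤-reflexive (sym d≡)))
      in step-or-detour adj Tji (intermediate? R T)
      where
      linR = linear-member dR
      linT = linear-member dT
      step-or-detour : ∀ {i j} → toℕ j ≡ suc (toℕ i) → Above T (lookup R j) (lookup R i) → Dec (Intermediate R T) →
                 PathIn D R T (suc (suc m))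
      step-or-detour {i} {j} adj Tji (no none) =
        step dR (alikeAt⇒alike (swap-alikeAt {R = R} adj)) (geodesic (swap-member dR dT adj Tji none) dT S-distance (smaller ℕ.≤-refl))
        where
        S-distance : distance (swap R i j) T ≡ m
        S-distance = ℕ.suc-injective
          (trans (sym (inversions-swap (Above? T) (swap-linear linR) (Above-asym linT) (swap-alikeAt {R = R} adj) Tji)) d≡)
      step-or-detour _ _ (yes intermediate) =
        let (M , dM , split , 1≤RM , 1≤MT) = majority-detour dR dT intermediate
            sum≡ = trans (sym split) d≡
        in subst (PathIn D R T) (trans (ℕ.+-suc _ _) (cong suc sum≡))
             (geodesic dR dM refl (smaller (subst (distance R M <_) sum≡ (ℕ.m<m+n _ 1≤MT)))
               ++ₚ geodesic dM dT refl (smaller (subst (distance M T <_) sum≡ (ℕ.m<n+m _ 1≤RM))))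

  private
    path-head : ∀ {S W k} → PathIn D S W k → D S
    path-head (single dS) = dS
    path-head (step dS _ _) = dS

  top-persists : ∀ {a b c} → Distinct3 a b c → ∀ {l} → (∀ W → D W → Avoids l p2 (restrict a b c W)) →
                 ∀ {R W k} → PathIn D R W k → first (restrict a b c R) ≡ l → first (restrict a b c W) ≡ l
  top-persists distinct avoids (single _) top = top
  top-persists {a} {b} {c} distinct {l} avoids {R} (step {S = S} dR alike path) top =
    let (_ , _ , al) = alike⇒alikeAt {R = R} {S} alike
        dS = path-head path
        (p , q , toward) = restrict-step a b c distinct (linear-member dR) (linear-member dS) (linear-member dS) al (Above-after al)
    in top-persists distinct avoids path (top-stable l p q _ _ toward (avoids R dR) (avoids S dS) top)

  connected⇒peak-pit : IsConnected D → IsPeakPit D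
  connected⇒peak-pit connected a b c distinct with condorcet a b c distinct
  ... | x , p1 , x∈abc , never-top = x , x∈abc , inj₁ never-top
  ... | x , p3 , x∈abc , never-bottom = x , x∈abc , inj₂ never-bottom
  ... | x , p2 , x∈abc , never-middle with letter-of a b c distinct x∈abc
  ...   | l , refl with ∃-word? (λ Q → member? Q ×-dec (first (restrict a b c Q) ≟ₗ l))
  ...     | yes (Q , dQ , top) = label a b c l , x∈abc , inj₂ (Equivalence.from (never⇔avoids l p3) λ W dW →
            subst (λ y → Avoids y p3 (restrict a b c W)) (top-persists distinct avoids-middle (proj₂ (connected Q W dQ dW)) top)
              (first-avoids-bottom (restrict a b c W)))
    where
    never⇔avoids = Never⇔Avoids a b c distinct isDom
    avoids-middle = Equivalence.to (never⇔avoids l p2) never-middle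
  ...     | no no-top = label a b c l , x∈abc ,
            inj₁ (Equivalence.from (Never⇔Avoids a b c distinct isDom l p1) λ W dW top → no-top (W , dW , top))

  peak-pit⇒directly-connected : IsPeakPit D → IsDirectlyConnected D
  peak-pit⇒directly-connected peakPit R T dR dT =
    suc (distance R T) , geodesic peakPit dR dT refl (<-wellFounded _) , λ _ path → path-length path

directly-connected⇒connected : {D : Domain n} → IsDirectlyConnected D → IsConnected D
directly-connected⇒connected directly R T dR dT = let (k , path , _) = directly R T dR dT in k , path

theorem3 : (n : ℕ) (D : Domain n) → IsMaximalCondorcet D →
           (IsPeakPit D ⇔ IsDirectlyConnected D) ×
           (IsDirectlyConnected D ⇔ IsConnected D)
theorem3 n D maximal =
  mk⇔ (peak-pit⇒directly-connected maximal) (connected⇒peak-pit maximal ∘ directly-connected⇒connected) ,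
  mk⇔ directly-connected⇒connected (peak-pit⇒directly-connected maximal ∘ connected⇒peak-pit maximal)
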